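{- For all integers $l > d \ge 0$, $$A(l,d) = \sum_{i=0}^{d}\left[\left(2^i - 1\right)\binom{l-i-1}{l-d-1}\right] + \binom{l}{d} - 1.$$
   Context: A rooted binary tree is a rooted tree in which every vertex has at most two children; the empty tree (0 vertices) is allowed. $B_m$ is the complete binary tree with $m$ layers, and a subdivision of $B_m$ is obtained by replacing some edges by paths; it is rooted at the root of $B_m$. A subdivision $S$ of $B_m$ is contained in a rooted tree $T$ as a compatible subgraph if $S$ is (isomorphic to) a subtree of $T$ such that the root of $S$ is the vertex of this subtree closest to the root of $T$. For integers $l,d\ge 0$, $A(l,d)$ is the maximum number $n$ such that there exists a rooted binary tree on $n$ vertices with at most $l$ layers that does not contain a subdivision of $B_{d+1}$ as a compatible subgraph. -}

module Defs where

open import Data.Nat using (ℕ; zero; suc; _+_; _*_; _∸_; _^_; _≤_; _⊔_)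
open import Data.Nat.Combinatorics using (_C_)
open import Data.List using (List; map; upTo)
open import Data.Nat.ListAction using (sum)
open import Data.Product using (Σ; _×_)
open import Data.Sum using (_⊎_)
open import Data.Unit using (⊤)
open import Data.Empty using (⊥)
open import Relation.Nullary using (¬_)
open import Relation.Binary.PropositionalEquality using (_≡_)

-- Rooted binary trees (possibly empty). Each vertex has at most two
-- children; 'leaf' is the empty tree (absent child).
data BTree : Set where
  leaf : BTree
  node : BTree → BTree → BTree

size : BTree → ℕ
size leaf       = 0
size (node l r) = suc (size l + size r)

layers : BTree → ℕ
layers leaf       = 0
layers (node l r) = suc (layers l ⊔ layers r)

mutual
  -- RootEmb m T : T contains a subdivision of B_m (complete binary tree with
  -- m layers) as a compatible subgraph whose root is the root of T.
  RootEmb : ℕ → BTree → Set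
  RootEmb zero          T          = ⊤
  RootEmb (suc m)       leaf       = ⊥
  RootEmb (suc zero)    (node l r) = ⊤
  RootEmb (suc (suc m)) (node l r) = Contains (suc m) l × Contains (suc m) r

  -- Contains m T : some vertex v of T is the root of a compatible subdivision
  -- of B_m inside the subtree of T hanging from v, i.e. T contains a
  -- subdivision of B_m as a compatible subgraph.
  Contains : ℕ → BTree → Set
  Contains m leaf       = RootEmb m leaf
  Contains m (node l r) = RootEmb m (node l r) ⊎ (Contains m l ⊎ Contains m r)

Admissible : ℕ → ℕ → BTree → Set
Admissible l d T = (layers T ≤ l) × ¬ Contains (suc d) T

-- IsA l d n : n = A(l,d), i.e. n is the maximum size of an admissible tree.
IsA : ℕ → ℕ → ℕ → Set
IsA l d n =
  Σ BTree (λ T → Admissible l d T × size T ≡ n)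
  × ((T : BTree) → Admissible l d T → size T ≤ n)

formula : ℕ → ℕ → ℕ
formula l d =
  sum (map (λ i → (2 ^ i ∸ 1) * ((l ∸ i ∸ 1) C (l ∸ d ∸ 1))) (upTo (suc d)))
  + (l C d) ∸ 1

module Submission where

-- Write  g l d  (maxSize below) for the maximum size of a binary tree with at
-- most l layers avoiding every subdivision of B_{d+1}.  Splitting a tree at
-- its root gives the recursion
--     g 0 d = 0,   g (l+1) 0 = 0,   g (l+1) (d+1) = 1 + g l (d+1) + g l d :
-- a tree avoiding B_{d+2} has two children avoiding B_{d+2}, and one of them
-- even avoids B_{d+1} (otherwise the root would carry a B_{d+2}); the tree
-- whose left child is extremal for (l, d+1) and right child extremal for
-- (l, d) attains the bound.  Hence A(l,d) = g l d for all l, d.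
--
-- For d < l the closed formula plus one,  F l d = Σ_{i≤d} w_i C(l-i-1,l-d-1)
-- + C(l,d)  with  w_i = 2^i - 1  (formula⁺ below), satisfies the same recursion: Pascal's rule
-- gives F (l+1) (d+1) = F l (d+1) + F l d when d+1 < l, and on the diagonal
-- F (d+2) (d+1) = 2^{d+1} + F (d+1) d, where 2^{d+1} = 1 + g (d+1) (d+1)
-- counts the complete tree.  Induction on l gives F l d = 1 + g l d.

open import Defs
open import Data.Nat using (ℕ; zero; suc; _+_; _*_; _∸_; _^_; _≤_; _<_; z≤n; s≤s)
open import Data.Nat.Properties
open import Data.Nat.Combinatorics
  using (_C_; nCn≡1; nC1≡n; nCk≡nC[n∸k]; nCk+nC[k+1]≡[n+1]C[k+1])
open import Data.List using ([]; _∷_; map; upTo; _++_)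
open import Data.List.Properties using (upTo-∷ʳ; map-++)
open import Data.Nat.ListAction using (sum)
open import Data.Nat.ListAction.Properties using (sum-++)
open import Data.Product using (_,_)
open import Data.Sum using (_⊎_; inj₁; inj₂)
open import Data.Unit using (tt)
open import Data.Empty using (⊥-elim)
open import Relation.Nullary using (¬_; Dec; yes; no)
open import Relation.Nullary.Decidable using (_×-dec_; _⊎-dec_)
open import Relation.Binary.PropositionalEquality
open import Algebra.Properties.CommutativeSemigroup +-commutativeSemigroup
  using (interchange; xy∙z≈xz∙y)
open import Data.Nat.Tactic.RingSolver using (solve-∀)

mutual
  rootEmb? : ∀ m T → Dec (RootEmb m T)
  rootEmb? zero          T          = yes tt
  rootEmb? (suc m)       leaf       = no λ ()
  rootEmb? (suc zero)    (node l r) = yes tt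
  rootEmb? (suc (suc m)) (node l r) = contains? (suc m) l ×-dec contains? (suc m) r

  contains? : ∀ m T → Dec (Contains m T)
  contains? m leaf       = rootEmb? m leaf
  contains? m (node l r) = rootEmb? m (node l r) ⊎-dec (contains? m l ⊎-dec contains? m r)

-- A subdivision of B_{m+1} contains a subdivision of B_m (drop the last layer).
mutual
  rootEmb-pred : ∀ m T → RootEmb (suc m) T → RootEmb m T
  rootEmb-pred zero          T          _       = tt
  rootEmb-pred (suc zero)    (node l r) _       = tt
  rootEmb-pred (suc (suc m)) (node l r) (a , b) =
    contains-pred (suc m) l a , contains-pred (suc m) r b

  contains-pred : ∀ m T → Contains (suc m) T → Contains m T
  contains-pred m (node l r) (inj₁ e)        = inj₁ (rootEmb-pred m (node l r) e)
  contains-pred m (node l r) (inj₂ (inj₁ c)) = inj₂ (inj₁ (contains-pred m l c))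
  contains-pred m (node l r) (inj₂ (inj₂ c)) = inj₂ (inj₂ (contains-pred m r c))

-- If a node avoids B_{d+2}, one of its children avoids B_{d+1}: otherwise the
-- two copies of B_{d+1} hang below the root and form a B_{d+2}.
someChildAvoids : ∀ d a b → ¬ Contains (suc (suc d)) (node a b) →
  ¬ Contains (suc d) a ⊎ ¬ Contains (suc d) b
someChildAvoids d a b avoid with contains? (suc d) a
... | no  ¬ca = inj₁ ¬ca
... | yes ca  = inj₂ λ cb → avoid (inj₁ (ca , cb))

maxSize : ℕ → ℕ → ℕ
maxSize zero    d       = 0
maxSize (suc l) zero    = 0
maxSize (suc l) (suc d) = suc (maxSize l (suc d) + maxSize l d)

extremalTree : ℕ → ℕ → BTree
extremalTree zero    d       = leaf
extremalTree (suc l) zero    = leaf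
extremalTree (suc l) (suc d) = node (extremalTree l (suc d)) (extremalTree l d)

size-extremalTree : ∀ l d → size (extremalTree l d) ≡ maxSize l d
size-extremalTree zero    d       = refl
size-extremalTree (suc l) zero    = refl
size-extremalTree (suc l) (suc d) =
  cong₂ (λ a b → suc (a + b)) (size-extremalTree l (suc d)) (size-extremalTree l d)

-- ... and is admissible; its right child avoids B_{d+1} by monotonicity,
-- since it even avoids B_d.
extremalTree-admissible : ∀ l d → Admissible l d (extremalTree l d)
extremalTree-admissible l d = layers≤ l d , avoids l d
  where
  layers≤ : ∀ l d → layers (extremalTree l d) ≤ l
  layers≤ zero    d       = z≤n
  layers≤ (suc l) zero    = z≤n
  layers≤ (suc l) (suc d) = s≤s (⊔-lub (layers≤ l (suc d)) (layers≤ l d))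

  avoids : ∀ l d → ¬ Contains (suc d) (extremalTree l d)
  avoids zero    d       ()
  avoids (suc l) zero    ()
  avoids (suc l) (suc d) (inj₁ (_ , cr))  = avoids l d cr
  avoids (suc l) (suc d) (inj₂ (inj₁ cl)) = avoids l (suc d) cl
  avoids (suc l) (suc d) (inj₂ (inj₂ cr)) =
    avoids l d (contains-pred (suc d) (extremalTree l d) cr)

left-layers : ∀ {l} a b → layers (node a b) ≤ suc l → layers a ≤ l
left-layers a b (s≤s ly) = ≤-trans (m≤m⊔n (layers a) (layers b)) ly

right-layers : ∀ {l} a b → layers (node a b) ≤ suc l → layers b ≤ l
right-layers a b (s≤s ly) = ≤-trans (m≤n⊔m (layers a) (layers b)) ly

-- Every admissible tree has at most maxSize l d vertices: both children avoid
-- B_{d+2} and one of them avoids B_{d+1}.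
admissible-size≤ : ∀ l d T → Admissible l d T → size T ≤ maxSize l d
admissible-size≤ l       d       leaf       _           = z≤n
admissible-size≤ zero    d       (node a b) (() , _)
admissible-size≤ (suc l) zero    (node a b) (_ , avoid) = ⊥-elim (avoid (inj₁ tt))
admissible-size≤ (suc l) (suc d) (node a b) (ly , avoid)
  with someChildAvoids d a b avoid
... | inj₁ ¬ca = s≤s (subst (_≤ maxSize l (suc d) + maxSize l d) (+-comm (size b) (size a))
                       (+-mono-≤ (admissible-size≤ l (suc d) b (right-layers a b ly , λ c → avoid (inj₂ (inj₂ c))))
                                 (admissible-size≤ l d a (left-layers a b ly , ¬ca))))
... | inj₂ ¬cb = s≤s (+-mono-≤ (admissible-size≤ l (suc d) a (left-layers a b ly , λ c → avoid (inj₂ (inj₁ c))))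
                               (admissible-size≤ l d b (right-layers a b ly , ¬cb)))

maxSize-isA : ∀ l d → IsA l d (maxSize l d)
maxSize-isA l d =
  (extremalTree l d , extremalTree-admissible l d , size-extremalTree l d)
  , admissible-size≤ l d

-- When d ≥ n every tree with n layers is admissible, so the extremal tree is
-- the complete one:  1 + maxSize n d = 2^n.
suc-maxSize-complete : ∀ n d → n ≤ d → suc (maxSize n d) ≡ 2 ^ n
suc-maxSize-complete zero    d       _         = refl
suc-maxSize-complete (suc n) (suc d) (s≤s n≤d) = begin
  suc (suc (maxSize n (suc d) + maxSize n d)) ≡⟨ cong suc (+-suc (maxSize n (suc d)) (maxSize n d)) ⟨
  suc (maxSize n (suc d)) + suc (maxSize n d) ≡⟨ cong₂ _+_ (suc-maxSize-complete n (suc d) (m≤n⇒m≤1+n n≤d))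
                                                          (suc-maxSize-complete n d n≤d) ⟩
  2 ^ n + 2 ^ n                                ≡⟨ cong (2 ^ n +_) (+-identityʳ (2 ^ n)) ⟨
  2 ^ suc n                                    ∎
  where open ≡-Reasoning

Σ< : ℕ → (ℕ → ℕ) → ℕ
Σ< zero    f = 0
Σ< (suc n) f = Σ< n f + f n

sum-upTo≡Σ< : ∀ n f → sum (map f (upTo n)) ≡ Σ< n f
sum-upTo≡Σ< zero    f = refl
sum-upTo≡Σ< (suc n) f = begin
  sum (map f (upTo (suc n)))           ≡⟨ cong (λ xs → sum (map f xs)) (upTo-∷ʳ n) ⟨
  sum (map f (upTo n ++ n ∷ []))       ≡⟨ cong sum (map-++ f (upTo n) (n ∷ [])) ⟩
  sum (map f (upTo n) ++ f n ∷ [])     ≡⟨ sum-++ (map f (upTo n)) (f n ∷ []) ⟩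
  sum (map f (upTo n)) + (f n + 0)     ≡⟨ cong₂ _+_ (sum-upTo≡Σ< n f) (+-identityʳ (f n)) ⟩
  Σ< n f + f n                         ∎
  where open ≡-Reasoning

Σ<-cong : ∀ n {f h} → (∀ i → i < n → f i ≡ h i) → Σ< n f ≡ Σ< n h
Σ<-cong zero    f≡h = refl
Σ<-cong (suc n) f≡h = cong₂ _+_ (Σ<-cong n λ i i<n → f≡h i (m<n⇒m<1+n i<n)) (f≡h n ≤-refl)

Σ<-+ : ∀ n f h → Σ< n (λ i → f i + h i) ≡ Σ< n f + Σ< n h
Σ<-+ zero    f h = refl
Σ<-+ (suc n) f h = trans (cong (_+ (f n + h n)) (Σ<-+ n f h))
                         (interchange (Σ< n f) (Σ< n h) (f n) (h n))

weight : ℕ → ℕ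
weight i = 2 ^ i ∸ 1

term : ℕ → ℕ → ℕ → ℕ
term l d i = weight i * ((l ∸ i ∸ 1) C (l ∸ d ∸ 1))

-- The closed formula plus one, avoiding truncated subtraction.
formula⁺ : ℕ → ℕ → ℕ
formula⁺ l d = Σ< (suc d) (term l d) + l C d

formula≡formula⁺∸1 : ∀ l d → formula l d ≡ formula⁺ l d ∸ 1
formula≡formula⁺∸1 l d = cong (λ s → s + l C d ∸ 1) (sum-upTo≡Σ< (suc d) (term l d))

∸-suc-pred : ∀ {i l} → i < l → suc l ∸ i ∸ 1 ≡ suc (l ∸ i ∸ 1)
∸-suc-pred {zero}  {suc l} _         = refl
∸-suc-pred {suc i} {suc l} (s≤s i<l) = ∸-suc-pred i<l

term-last : ∀ l d → term l d d ≡ weight d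
term-last l d = trans (cong (weight d *_) (nCn≡1 (l ∸ d ∸ 1))) (*-identityʳ (weight d))

term-adjacent : ∀ d i → term (suc d) d i ≡ weight i
term-adjacent d i = begin
  weight i * ((suc d ∸ i ∸ 1) C (suc d ∸ d ∸ 1)) ≡⟨ cong (λ k → weight i * ((suc d ∸ i ∸ 1) C (k ∸ 1)))
                                                        (m+n∸n≡m 1 d) ⟩
  weight i * 1                                    ≡⟨ *-identityʳ (weight i) ⟩
  weight i                                        ∎
  where open ≡-Reasoning

term-pascal : ∀ {l d i} → suc d < l → i ≤ d →
  term (suc l) (suc d) i ≡ term l (suc d) i + term l d i
term-pascal {suc l} {d} {i} (s≤s d<l) i≤d = begin
  w * ((suc (suc l) ∸ i ∸ 1) C k)   ≡⟨ cong₂ (λ n k → w * (n C k)) (∸-suc-pred i<sl) (∸-suc-pred d<l) ⟩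
  w * (suc n C suc k′)              ≡⟨ cong (w *_) (nCk+nC[k+1]≡[n+1]C[k+1] n k′) ⟨
  w * (n C k′ + n C suc k′)         ≡⟨ *-distribˡ-+ w (n C k′) (n C suc k′) ⟩
  w * (n C k′) + w * (n C suc k′)   ≡⟨ cong (λ k → w * (n C k′) + w * (n C k)) (∸-suc-pred d<l) ⟨
  w * (n C k′) + w * (n C k)        ∎
  where
  open ≡-Reasoning
  w n k k′ : ℕ
  w  = weight i
  n  = suc l ∸ i ∸ 1
  k  = suc l ∸ d ∸ 1
  k′ = l ∸ d ∸ 1
  i<sl : i < suc l
  i<sl = s≤s (≤-trans i≤d (<⇒≤ d<l))

formula⁺-pascal : ∀ l d → suc d < l →
  formula⁺ (suc l) (suc d) ≡ formula⁺ l (suc d) + formula⁺ l d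
formula⁺-pascal l d sd<l = begin
  (Σ< (suc d) (term (suc l) (suc d)) + term (suc l) (suc d) (suc d)) + suc l C suc d
    ≡⟨ cong₂ (λ s t → (s + t) + suc l C suc d) sum-split last ⟩
  ((Σ< (suc d) (term l (suc d)) + Σ< (suc d) (term l d)) + term l (suc d) (suc d)) + suc l C suc d
    ≡⟨ cong₂ _+_ (xy∙z≈xz∙y (Σ< (suc d) (term l (suc d))) _ _)
                 (nCk+nC[k+1]≡[n+1]C[k+1] l d) ⟨
  (Σ< (suc (suc d)) (term l (suc d)) + Σ< (suc d) (term l d)) + (l C d + l C suc d)
    ≡⟨ cong ((Σ< (suc (suc d)) (term l (suc d)) + Σ< (suc d) (term l d)) +_)
            (+-comm (l C d) (l C suc d)) ⟩
  (Σ< (suc (suc d)) (term l (suc d)) + Σ< (suc d) (term l d)) + (l C suc d + l C d)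
    ≡⟨ interchange (Σ< (suc (suc d)) (term l (suc d))) _ _ _ ⟩
  formula⁺ l (suc d) + formula⁺ l d
    ∎
  where
  open ≡-Reasoning
  sum-split : Σ< (suc d) (term (suc l) (suc d))
            ≡ Σ< (suc d) (term l (suc d)) + Σ< (suc d) (term l d)
  sum-split = trans (Σ<-cong (suc d) λ i i<sd → term-pascal sd<l (≤-pred i<sd))
                    (Σ<-+ (suc d) (term l (suc d)) (term l d))
  last : term (suc l) (suc d) (suc d) ≡ term l (suc d) (suc d)
  last = trans (term-last (suc l) (suc d)) (sym (term-last l (suc d)))

formula⁺-adjacent : ∀ d → formula⁺ (suc d) d ≡ Σ< (suc d) weight + suc d
formula⁺-adjacent d = cong₂ _+_ (Σ<-cong (suc d) λ i _ → term-adjacent d i) Cd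
  where
  Cd : suc d C d ≡ suc d
  Cd = trans (nCk≡nC[n∸k] (n≤1+n d))
             (trans (cong (suc d C_) (m+n∸n≡m 1 d)) (nC1≡n (suc d)))

-- On the diagonal the complete tree contributes 2^{d+1}.
formula⁺-diagonal : ∀ d → formula⁺ (suc (suc d)) (suc d) ≡ 2 ^ suc d + formula⁺ (suc d) d
formula⁺-diagonal d = begin
  formula⁺ (suc (suc d)) (suc d)          ≡⟨ formula⁺-adjacent (suc d) ⟩
  (S + weight (suc d)) + suc (suc d)      ≡⟨ rearrange S (weight (suc d)) d ⟩
  (weight (suc d) + 1) + (S + suc d)      ≡⟨ cong₂ _+_ (m∸n+n≡m (m^n>0 2 (suc d)))
                                                       (sym (formula⁺-adjacent d)) ⟩
  2 ^ suc d + formula⁺ (suc d) d          ∎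
  where
  open ≡-Reasoning
  S : ℕ
  S = Σ< (suc d) weight
  rearrange : ∀ s w d → (s + w) + suc (suc d) ≡ (w + 1) + (s + suc d)
  rearrange = solve-∀

formula⁺≡suc-maxSize : ∀ l d → d < l → formula⁺ l d ≡ suc (maxSize l d)
formula⁺≡suc-maxSize (suc l) zero    _         = refl
formula⁺≡suc-maxSize (suc l) (suc d) (s≤s d<l) with m≤n⇒m<n∨m≡n d<l
... | inj₁ sd<l = begin
  formula⁺ (suc l) (suc d)                         ≡⟨ formula⁺-pascal l d sd<l ⟩
  formula⁺ l (suc d) + formula⁺ l d                ≡⟨ cong₂ _+_ (formula⁺≡suc-maxSize l (suc d) sd<l)
                                                                (formula⁺≡suc-maxSize l d d<l) ⟩
  suc (maxSize l (suc d)) + suc (maxSize l d)      ≡⟨ cong suc (+-suc (maxSize l (suc d)) (maxSize l d)) ⟩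
  suc (maxSize (suc l) (suc d))                    ∎
  where open ≡-Reasoning
... | inj₂ refl = begin
  formula⁺ (suc (suc d)) (suc d)                   ≡⟨ formula⁺-diagonal d ⟩
  2 ^ suc d + formula⁺ (suc d) d                   ≡⟨ cong₂ _+_ (sym (suc-maxSize-complete (suc d) (suc d) ≤-refl))
                                                                (formula⁺≡suc-maxSize (suc d) d d<l) ⟩
  suc (maxSize (suc d) (suc d)) + suc (maxSize (suc d) d)
                                                   ≡⟨ cong suc (+-suc (maxSize (suc d) (suc d)) _) ⟩
  suc (maxSize (suc (suc d)) (suc d))              ∎
  where open ≡-Reasoning

lemma16 : (l d : ℕ) → d < l → IsA l d (formula l d)
lemma16 l d d<l = subst (IsA l d) (sym formula≡maxSize) (maxSize-isA l d)
  where
  formula≡maxSize : formula l d ≡ maxSize l d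
  formula≡maxSize = trans (formula≡formula⁺∸1 l d)
                          (cong (_∸ 1) (formula⁺≡suc-maxSize l d d<l))
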